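{- Let $M_0,M_1,M_2,M_3$ be edge-disjoint matchings of sizes $m_0,m_1,m_2,m_3$ such that $M_0 \cup M_1$, $M_1 \cup M_2$ and $M_2 \cup M_3$ are also matchings. Then, for any orderings $\ell_0,\ell_1,\ell_2,\ell_3$ of $M_0,M_1,M_2,M_3$ respectively, \[ \mathrm{ms}(\ell_0 \vee \ell_1 \vee \ell_2\vee \ell_3) \geq \min\{\mathrm{ms}(\ell_0 \vee \ell_2)+m_1,\ \mathrm{ms}(\ell_1 \vee \ell_3)+m_2,\ \mathrm{ms}(\ell_0 \vee \ell_3)+m_1+m_2\}. \]
   Context: All graphs are simple; a matching is a 1-regular graph; two edges are adjacent if they share a vertex. An ordering of a graph $G$ with $m$ edges is a bijection $\ell:E(G)\to\mathbb{Z}_m$; for distinct edges $e,e'$, $d_\ell(e,e')$ is the smallest positive integer $d$ with $\ell(e)+d=\ell(e')$ in $\mathbb{Z}_m$. $\mathrm{ms}(\ell)$ is the largest $s\in\{1,\dots,m\}$ such that $d_\ell(e,e')\geq s$ for every ordered pair $(e,e')$ of adjacent edges with $\ell(e)<\ell(e')$ (labels compared as integers in $\{0,\dots,m-1\}$). For edge-disjoint graphs $G_0,G_1$ with orderings $\ell_0,\ell_1$, $\ell_0\vee\ell_1$ is the ordering $\ell$ of $G_0\cup G_1$ with $\ell(e)=\ell_0(e)$ for $e\in E(G_0)$ and $\ell(e)=|E(G_0)|+\ell_1(e)$ for $e\in E(G_1)$; this operation is associative. -}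

module Defs where

open import Data.Nat using (ℕ; _≤_; _<_; _∸_)
open import Data.Product using (_×_; _,_)
open import Data.Sum using (_⊎_)
open import Data.Fin using (Fin; toℕ)
open import Data.List using (List; length; lookup)
open import Data.List.Relation.Unary.All using (All)
open import Data.List.Relation.Unary.Any using (Any)
open import Data.List.Relation.Unary.AllPairs using (AllPairs)
open import Data.List.Membership.Propositional using (_∈_)
open import Relation.Binary.PropositionalEquality using (_≡_; _≢_)
open import Relation.Nullary using (¬_)

-- An edge {u,v} of a simple graph is stored
-- canonically as the pair (u , v) with u < v, so that equality of edges
-- (as 2-element vertex sets) is propositional equality of pairs.
Edge : Set
Edge = ℕ × ℕ

ValidEdge : Edge → Set
ValidEdge (u , v) = u < v

SharesVertex : Edge → Edge → Set
SharesVertex (a , b) (c , d) = (a ≡ c ⊎ a ≡ d) ⊎ (b ≡ c ⊎ b ≡ d)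

Adjacent : Edge → Edge → Set
Adjacent e e' = e ≢ e' × SharesVertex e e'

-- A list of edges; it represents the graph whose edge set is the set of its
-- entries.  A duplicate-free list of the edges of a graph G is exactly an
-- ordering of G: the edge at position i gets label i ∈ ℤ_m, m = length.

-- The edges in the list form a matching (a 1-regular graph): all edges are
-- valid, and any two entries at different positions are vertex-disjoint
-- (in particular the list has no duplicates).
IsMatching : List Edge → Set
IsMatching L = All ValidEdge L × AllPairs (λ e e' → ¬ SharesVertex e e') L

EdgeDisjoint : List Edge → List Edge → Set
EdgeDisjoint L L' = ∀ e → e ∈ L → ¬ (e ∈ L')

-- d_ℓ(e,e') for labels i < j (as integers in {0..m-1}): the smallest
-- positive d with i + d = j in ℤ_m, which is j - i.
dist : ℕ → ℕ → ℕ
dist i j = j ∸ i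

GapAtLeast : List Edge → ℕ → Set
GapAtLeast L s =
  (i j : Fin (length L)) → toℕ i < toℕ j →
  Adjacent (lookup L i) (lookup L j) → s ≤ dist (toℕ i) (toℕ j)

IsMs : List Edge → ℕ → Set
IsMs L s =
  1 ≤ s × s ≤ length L × GapAtLeast L s ×
  (∀ s' → 1 ≤ s' → s' ≤ length L → GapAtLeast L s' → s' ≤ s)

-- Split the concatenation ℓ₀ ℓ₁ ℓ₂ ℓ₃ into its four blocks.  Adjacent pairs inside one
-- block, or in consecutive blocks ℓ₀ℓ₁, ℓ₁ℓ₂, ℓ₂ℓ₃, do not exist because those
-- unions are matchings.  Every other adjacent pair (e, e') also occurs in one of
-- the shorter orderings ℓ₀ ∨ ℓ₂, ℓ₁ ∨ ℓ₃, ℓ₀ ∨ ℓ₃, where its distance is at least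
-- the corresponding ms; in the long ordering the blocks lying between e and e'
-- are inserted, adding m₁, m₂ or m₁ + m₂ to that distance.
module Submission where

open import Defs
open import Data.Nat using (ℕ; suc; _≤_; _<_; _+_; _∸_; _⊓_; s≤s; z≤n)
open import Data.Nat.Properties
open import Data.Nat.Tactic.RingSolver using (solve-∀)
open import Data.Fin using (Fin; toℕ)
import Data.Fin as Fin
open import Data.List using (List; []; _∷_; length; lookup; _++_)
open import Data.List.Properties using (length-++)
open import Data.List.Relation.Unary.All using (All; _∷_)
open import Data.List.Relation.Unary.AllPairs using (AllPairs; _∷_)
open import Data.Product using (Σ-syntax; _×_; _,_)
open import Data.Sum using (_⊎_; inj₁; inj₂)
open import Data.Empty using (⊥-elim)
open import Relation.Binary.PropositionalEquality using (_≡_; refl; sym; cong; subst)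

private
  variable
    A : Set
    x e e' : A
    xs ys : List A
    i j : ℕ

infix 4 _[_]=_

data _[_]=_ {A : Set} : List A → ℕ → A → Set where
  here  : x ∷ xs [ 0 ]= x
  there : xs [ i ]= e → x ∷ xs [ suc i ]= e

[]=⇒<length : xs [ i ]= e → i < length xs
[]=⇒<length here      = s≤s z≤n
[]=⇒<length (there p) = s≤s ([]=⇒<length p)

[]=-++⁺ˡ : xs [ i ]= e → xs ++ ys [ i ]= e
[]=-++⁺ˡ here      = here
[]=-++⁺ˡ (there p) = there ([]=-++⁺ˡ p)

[]=-++⁺ʳ : (xs : List A) → ys [ i ]= e → xs ++ ys [ length xs + i ]= e
[]=-++⁺ʳ []       p = p
[]=-++⁺ʳ (x ∷ xs) p = there ([]=-++⁺ʳ xs p)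

[]=-++⁻ : (xs : List A) → xs ++ ys [ i ]= e →
          xs [ i ]= e ⊎ Σ[ k ∈ ℕ ] i ≡ length xs + k × ys [ k ]= e
[]=-++⁻ []       p         = inj₂ (_ , refl , p)
[]=-++⁻ (x ∷ xs) here      = inj₁ here
[]=-++⁻ (x ∷ xs) (there p) with []=-++⁻ xs p
... | inj₁ q              = inj₁ (there q)
... | inj₂ (k , refl , q) = inj₂ (k , refl , q)

lookup⇒[]= : (xs : List A) (i : Fin (length xs)) → xs [ toℕ i ]= lookup xs i
lookup⇒[]= (x ∷ xs) Fin.zero    = here
lookup⇒[]= (x ∷ xs) (Fin.suc i) = there (lookup⇒[]= xs i)

[]=⇒lookup : xs [ i ]= e → Σ[ k ∈ Fin (length xs) ] toℕ k ≡ i × lookup xs k ≡ e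
[]=⇒lookup here = Fin.zero , refl , refl
[]=⇒lookup (there p) with []=⇒lookup p
... | k , refl , refl = Fin.suc k , refl , refl

All-[]= : {P : A → Set} → All P xs → xs [ i ]= e → P e
All-[]= (px ∷ _)  here      = px
All-[]= (_ ∷ pxs) (there p) = All-[]= pxs p

AllPairs-[]= : {R : A → A → Set} → AllPairs R xs →
               xs [ i ]= e → xs [ j ]= e' → i < j → R e e'
AllPairs-[]= (rx ∷ _)   here      (there q) _       = All-[]= rx q
AllPairs-[]= (_ ∷ rxs) (there p) (there q) (s≤s i<j) = AllPairs-[]= rxs p q i<j

length-++-swap≤ : (xs ys zs ws : List A) →
                  length (xs ++ zs) + length ys ≤ length (xs ++ ys ++ zs ++ ws)
length-++-swap≤ xs ys zs ws = begin
  length (xs ++ zs) + length ys                     ≡⟨ cong (_+ length ys) (length-++ xs) ⟩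
  length xs + length zs + length ys                 ≤⟨ m≤m+n _ (length ws) ⟩
  length xs + length zs + length ys + length ws     ≡⟨ reassoc (length xs) (length ys) (length zs) (length ws) ⟩
  length xs + (length ys + (length zs + length ws)) ≡⟨ cong (λ n → length xs + (length ys + n)) (length-++ zs) ⟨
  length xs + (length ys + length (zs ++ ws))       ≡⟨ cong (length xs +_) (length-++ ys) ⟨
  length xs + length (ys ++ zs ++ ws)               ≡⟨ length-++ xs ⟨
  length (xs ++ ys ++ zs ++ ws)                     ∎
  where
  open ≤-Reasoning
  reassoc : ∀ a b c d → a + c + b + d ≡ a + (b + (c + d))
  reassoc = solve-∀

Gap : List Edge → ℕ → Set
Gap L s = ∀ {i j e e'} → L [ i ]= e → L [ j ]= e' → i < j → Adjacent e e' → s ≤ j ∸ i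

-- ys is placed d positions after the end of xs.
CrossGap : ℕ → List Edge → List Edge → ℕ → Set
CrossGap d xs ys s = ∀ {a b e e'} → xs [ a ]= e → ys [ b ]= e' → Adjacent e e' →
                     s ≤ length xs ∸ a + (d + b)

private
  variable
    L us vs ws : List Edge
    d s s' : ℕ

GapAtLeast⇒Gap : GapAtLeast L s → Gap L s
GapAtLeast⇒Gap g p q i<j adj with []=⇒lookup p | []=⇒lookup q
... | i , refl , refl | j , refl , refl = g i j i<j adj

Gap⇒GapAtLeast : Gap L s → GapAtLeast L s
Gap⇒GapAtLeast {L} g i j = g (lookup⇒[]= L i) (lookup⇒[]= L j)

matching⇒Gap : IsMatching L → Gap L s
matching⇒Gap (_ , disjoint) p q i<j (_ , shared) =
  ⊥-elim (AllPairs-[]= disjoint p q i<j shared)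

matching⇒CrossGap : IsMatching (us ++ vs) → CrossGap d us vs s
matching⇒CrossGap {us} (_ , disjoint) {b = b} p q (_ , shared) =
  ⊥-elim (AllPairs-[]= disjoint ([]=-++⁺ˡ p) ([]=-++⁺ʳ us q)
           (<-≤-trans ([]=⇒<length p) (m≤m+n (length us) b)) shared)

Gap⇒CrossGap : Gap (us ++ vs) s → CrossGap 0 us vs s
Gap⇒CrossGap {us} {s = s} g {b = b} p q adj =
  subst (s ≤_) (+-∸-comm b (<⇒≤ ([]=⇒<length p)))
    (g ([]=-++⁺ˡ p) ([]=-++⁺ʳ us q) (<-≤-trans ([]=⇒<length p) (m≤m+n (length us) b)) adj)

Gap-++ : Gap us s → Gap vs s → CrossGap 0 us vs s → Gap (us ++ vs) s
Gap-++ {us} {s = s} gu gv cross p q i<j adj with []=-++⁻ us p | []=-++⁻ us q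
... | inj₁ p′ | inj₁ q′ = gu p′ q′ i<j adj
... | inj₁ p′ | inj₂ (b , refl , q′) =
  subst (s ≤_) (sym (+-∸-comm b (<⇒≤ ([]=⇒<length p′)))) (cross p′ q′ adj)
... | inj₂ (a , refl , _) | inj₁ q′ =
  ⊥-elim (<-asym (<-≤-trans ([]=⇒<length q′) (m≤m+n (length us) a)) i<j)
... | inj₂ (a , refl , p′) | inj₂ (b , refl , q′) =
  subst (s ≤_) (sym ([m+n]∸[m+o]≡n∸o (length us) b a))
    (gv p′ q′ (+-cancelˡ-< (length us) a b i<j) adj)

CrossGap-++ : CrossGap d us vs s → CrossGap (length vs + d) us ws s →
              CrossGap d us (vs ++ ws) s
CrossGap-++ {d} {us} {vs} {s = s} cv cw {a} p q adj with []=-++⁻ vs q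
... | inj₁ q′ = cv p q′ adj
... | inj₂ (k , refl , q′) =
  subst (s ≤_) (reassoc (length us ∸ a) (length vs) d k) (cw p q′ adj)
  where
  reassoc : ∀ x m d k → x + ((m + d) + k) ≡ x + (d + (m + k))
  reassoc = solve-∀

CrossGap-shift : ∀ p → CrossGap d us vs s → CrossGap (p + d) us vs (s + p)
CrossGap-shift {d} {us} {s = s} p c {a} {b} p′ q adj =
  subst (s + p ≤_) (reassoc (length us ∸ a) d b p) (+-monoˡ-≤ p (c p′ q adj))
  where
  reassoc : ∀ x d b p → x + (d + b) + p ≡ x + ((p + d) + b)
  reassoc = solve-∀

CrossGap-mono : s' ≤ s → CrossGap d us vs s → CrossGap d us vs s'
CrossGap-mono s'≤s c p q adj = ≤-trans s'≤s (c p q adj)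

lemma2p4 : (ℓ₀ ℓ₁ ℓ₂ ℓ₃ : List Edge) →
    IsMatching ℓ₀ → IsMatching ℓ₁ → IsMatching ℓ₂ → IsMatching ℓ₃ →
    EdgeDisjoint ℓ₀ ℓ₁ → EdgeDisjoint ℓ₀ ℓ₂ → EdgeDisjoint ℓ₀ ℓ₃ →
    EdgeDisjoint ℓ₁ ℓ₂ → EdgeDisjoint ℓ₁ ℓ₃ → EdgeDisjoint ℓ₂ ℓ₃ →
    IsMatching (ℓ₀ ++ ℓ₁) → IsMatching (ℓ₁ ++ ℓ₂) → IsMatching (ℓ₂ ++ ℓ₃) →
    (s s₀₂ s₁₃ s₀₃ : ℕ) →
    IsMs (ℓ₀ ++ ℓ₁ ++ ℓ₂ ++ ℓ₃) s →
    IsMs (ℓ₀ ++ ℓ₂) s₀₂ → IsMs (ℓ₁ ++ ℓ₃) s₁₃ → IsMs (ℓ₀ ++ ℓ₃) s₀₃ →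
    (s₀₂ + length ℓ₁) ⊓ ((s₁₃ + length ℓ₂) ⊓ (s₀₃ + length ℓ₁ + length ℓ₂)) ≤ s
lemma2p4 ℓ₀ ℓ₁ ℓ₂ ℓ₃ M₀ M₁ _ _ _ _ _ _ _ _ M₀₁ M₁₂ M₂₃ s s₀₂ s₁₃ s₀₃
         (_ , _ , _ , maximal) (1≤s₀₂ , s₀₂≤ , g₀₂ , _) (1≤s₁₃ , _ , g₁₃ , _) (1≤s₀₃ , _ , g₀₃ , _) =
  maximal t 1≤t t≤length (Gap⇒GapAtLeast gap)
  where
  m₁ = length ℓ₁
  m₂ = length ℓ₂
  t = (s₀₂ + m₁) ⊓ ((s₁₃ + m₂) ⊓ (s₀₃ + m₁ + m₂))

  t≤₀₂ : t ≤ s₀₂ + m₁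
  t≤₀₂ = m⊓n≤m _ _
  t≤₁₃ : t ≤ s₁₃ + m₂
  t≤₁₃ = ≤-trans (m⊓n≤n (s₀₂ + m₁) _) (m⊓n≤m _ _)
  t≤₀₃ : t ≤ s₀₃ + m₁ + m₂
  t≤₀₃ = ≤-trans (m⊓n≤n (s₀₂ + m₁) _) (m⊓n≤n _ _)

  1≤t : 1 ≤ t
  1≤t = ⊓-glb (m≤n⇒m≤n+o m₁ 1≤s₀₂)
          (⊓-glb (m≤n⇒m≤n+o m₂ 1≤s₁₃) (m≤n⇒m≤n+o m₂ (m≤n⇒m≤n+o m₁ 1≤s₀₃)))

  t≤length : t ≤ length (ℓ₀ ++ ℓ₁ ++ ℓ₂ ++ ℓ₃)
  t≤length = ≤-trans t≤₀₂ (≤-trans (+-monoˡ-≤ m₁ s₀₂≤)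
               (length-++-swap≤ ℓ₀ ℓ₁ ℓ₂ ℓ₃))

  cross₁ : CrossGap 0 ℓ₁ (ℓ₂ ++ ℓ₃) t
  cross₁ = CrossGap-++ (matching⇒CrossGap M₁₂)
             (CrossGap-mono t≤₁₃ (CrossGap-shift m₂ (Gap⇒CrossGap (GapAtLeast⇒Gap g₁₃))))

  cross₀ : CrossGap 0 ℓ₀ (ℓ₁ ++ ℓ₂ ++ ℓ₃) t
  cross₀ = CrossGap-++ (matching⇒CrossGap M₀₁) (CrossGap-++
             (CrossGap-mono t≤₀₂ (CrossGap-shift m₁ (Gap⇒CrossGap (GapAtLeast⇒Gap g₀₂))))
             (CrossGap-mono t≤₀₃ (CrossGap-shift m₂ (CrossGap-shift m₁
               (Gap⇒CrossGap (GapAtLeast⇒Gap g₀₃))))))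

  gap : Gap (ℓ₀ ++ ℓ₁ ++ ℓ₂ ++ ℓ₃) t
  gap = Gap-++ (matching⇒Gap M₀) (Gap-++ (matching⇒Gap M₁) (matching⇒Gap M₂₃) cross₁) cross₀
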